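{- Let $\lambda\in\mathbb{R}$. As formal power series in $x$ (with coefficients in $\mathbb{R}[[t]]$), \[ \frac{t-1}{t-e_{ -\lambda}\big((t-1)x\big)}=\sum_{n=0}^{\infty}A_{n,\lambda}(t)\frac{x^{n}}{n!}. \]
   Context: For $\mu\in\mathbb{R}$, $(y)_{0,\mu}=1$ and $(y)_{n,\mu}=y(y-\mu)\cdots(y-(n-1)\mu)$ for $n\ge1$. The degenerate exponential is $e_{\mu}^{y}(s)=\sum_{n=0}^{\infty}(y)_{n,\mu}\frac{s^{n}}{n!}$ and $e_\mu(s)=e_\mu^1(s)$; in particular $e_{ -\lambda}(s)=\sum_{n\ge0}(1)_{n,-\lambda}\frac{s^n}{n!}$. The degenerate Eulerian polynomials $A_{n,\lambda}(t)$ ($n\ge0$) are defined by $\frac{A_{n,\lambda}(t)}{(1-t)^{n+1}}=\sum_{j=0}^{\infty}(j+1)_{n,\lambda}t^{j}$ (as formal power series in $t$). -}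

module Defs where

open import Level using (Level)
open import Data.Nat using (ℕ; zero; suc; _∸_)
open import Data.Nat.Combinatorics using (_C_)
open import Algebra.Bundles using (CommutativeRing)

-- Everything is parametrised by a commutative ring R of coefficients
-- (the paper uses R = ℝ) and by the parameter lam ∈ R (the paper's λ).
module Series {c ℓ : Level} (R : CommutativeRing c ℓ) where
  open CommutativeRing R

  ι : ℕ → Carrier
  ι zero    = 0#
  ι (suc n) = 1# + ι n

  Σ≤ : ℕ → (ℕ → Carrier) → Carrier
  Σ≤ zero    f = f 0
  Σ≤ (suc n) f = Σ≤ n f + f (suc n)

  ff : Carrier → Carrier → ℕ → Carrier
  ff y μ zero    = 1#
  ff y μ (suc n) = ff y μ n * (y + - (ι n * μ))

  PS : Set c
  PS = ℕ → Carrier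

  _≈PS_ : PS → PS → Set ℓ
  f ≈PS g = ∀ j → f j ≈ g j

  0PS : PS
  0PS _ = 0#

  constPS : Carrier → PS
  constPS a zero    = a
  constPS a (suc _) = 0#

  1PS : PS
  1PS = constPS 1#

  tPS : PS
  tPS zero          = 0#
  tPS (suc zero)    = 1#
  tPS (suc (suc _)) = 0#

  _⊕_ : PS → PS → PS
  (f ⊕ g) j = f j + g j

  ⊖_ : PS → PS
  (⊖ f) j = - f j

  _·PS_ : Carrier → PS → PS
  (a ·PS f) j = a * f j

  _⊛_ : PS → PS → PS
  (f ⊛ g) j = Σ≤ j (λ k → f k * g (j ∸ k))

  _^PS_ : PS → ℕ → PS
  f ^PS zero  = 1PS
  f ^PS suc n = (f ^PS n) ⊛ f

  oneMinusT : PS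
  oneMinusT = 1PS ⊕ (⊖ tPS)

  tMinusOne : PS
  tMinusOne = tPS ⊕ (⊖ 1PS)

  A : Carrier → ℕ → PS
  A lam n = (oneMinusT ^PS suc n) ⊛ (λ j → ff (ι (suc j)) lam n)

  -- Formal power series in x with coefficients in R[[t]], written in
  -- exponential form: F : ℕ → PS represents  Σ_n F n · x^n / n!.
  -- Their product is the binomial (Hurwitz) convolution.
  EPS : Set c
  EPS = ℕ → PS

  _≈EPS_ : EPS → EPS → Set ℓ
  F ≈EPS G = ∀ n → F n ≈PS G n

  _⊞_ : EPS → EPS → EPS
  (F ⊞ G) n = F n ⊕ G n

  ⊟_ : EPS → EPS
  (⊟ F) n = ⊖ F n

  _⋆_ : EPS → EPS → EPS
  (F ⋆ G) n j = Σ≤ n (λ k → (ι (n C k) ·PS (F k ⊛ G (n ∸ k))) j)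

  constE : PS → EPS
  constE p zero    = p
  constE p (suc _) = 0PS

  -- e_μ(s) = Σ (1)_{n,μ} s^n/n!  evaluated at s = (t-1)x:
  -- coefficient of x^n/n! is (1)_{n,μ} (t-1)^n
  eDegAt : Carrier → EPS
  eDegAt μ n = ff 1# μ n ·PS (tMinusOne ^PS n)

  denom : Carrier → EPS
  denom lam = constE tPS ⊞ (⊟ eDegAt (- lam))

  Agen : Carrier → EPS
  Agen lam n = A lam n

-- Write U = 1 - t and (y)ₙ for the degenerate falling factorial (y)_{n,λ}.
-- By definition A_{k} = U^{k+1} Σⱼ (j+1)ₖ tʲ, and the coefficient of xᵐ/m! in
-- e_{-λ}((t-1)x) is (1)_{m,-λ} (t-1)ᵐ = (-1)ₘ Uᵐ.  Hence the x-binomial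
-- convolution of A with that exponential is U^{n+1} Σⱼ Σₖ (n choose k)(j+1)ₖ(-1)ₙ₋ₖ tʲ,
-- which by the degenerate Vandermonde identity is U^{n+1} Σⱼ (j)ₙ tʲ.  The
-- convolution of A with the constant t is t·Aₙ = U^{n+1} Σⱼ (j+1)ₙ t^{j+1}, so the
-- difference telescopes to U^{n+1}·(-(0)ₙ), which is t - 1 for n = 0 and 0 otherwise.
module Submission where

open import Level using (Level)
open import Algebra.Bundles using (CommutativeRing)
open import Data.Nat using (ℕ; zero; suc; _∸_; _≤_; _<_; z≤n; s≤s)
import Data.Nat as ℕ
import Data.Nat.Properties as ℕ
open import Data.Nat.Combinatorics using (_C_; nCn≡1; k>n⇒nCk≡0; nCk+nC[k+1]≡[n+1]C[k+1])
open import Relation.Binary.Bundles using (Setoid)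
open import Relation.Binary.PropositionalEquality as P using (_≡_)
import Relation.Binary.Reasoning.Setoid as SetoidReasoning
open import Defs

module SeriesLemmas {c ℓ : Level} (R : CommutativeRing c ℓ) where
  open CommutativeRing R
  open Series R
  open import Algebra.Properties.Ring ring using (-‿distribˡ-*; -‿distribʳ-*; -‿+-comm; -‿involutive; -0#≈0#; -1*x≈-x)
  open import Algebra.Solver.Ring.NaturalCoefficients.Default commutativeSemiring
  module R-Reasoning = SetoidReasoning setoid

  Σ≤-cong≤ : ∀ n {f g : ℕ → Carrier} → (∀ k → k ≤ n → f k ≈ g k) → Σ≤ n f ≈ Σ≤ n g
  Σ≤-cong≤ zero    f≈g = f≈g 0 z≤n
  Σ≤-cong≤ (suc n) f≈g = +-cong (Σ≤-cong≤ n (λ k k≤n → f≈g k (ℕ.m≤n⇒m≤1+n k≤n))) (f≈g (suc n) ℕ.≤-refl)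

  Σ≤-cong : ∀ n {f g : ℕ → Carrier} → (∀ k → f k ≈ g k) → Σ≤ n f ≈ Σ≤ n g
  Σ≤-cong n f≈g = Σ≤-cong≤ n (λ k _ → f≈g k)

  Σ≤-distrib-+ : ∀ n (f g : ℕ → Carrier) → Σ≤ n (λ k → f k + g k) ≈ Σ≤ n f + Σ≤ n g
  Σ≤-distrib-+ zero    f g = refl
  Σ≤-distrib-+ (suc n) f g = trans (+-congʳ (Σ≤-distrib-+ n f g))
    (solve 4 (λ a b x y → (a :+ b) :+ (x :+ y) := (a :+ x) :+ (b :+ y)) refl
      (Σ≤ n f) (Σ≤ n g) (f (suc n)) (g (suc n)))

  Σ≤-*ˡ : ∀ n a (f : ℕ → Carrier) → Σ≤ n (λ k → a * f k) ≈ a * Σ≤ n f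
  Σ≤-*ˡ zero    a f = refl
  Σ≤-*ˡ (suc n) a f = trans (+-congʳ (Σ≤-*ˡ n a f)) (sym (distribˡ a _ _))

  Σ≤-*ʳ : ∀ n a (f : ℕ → Carrier) → Σ≤ n (λ k → f k * a) ≈ Σ≤ n f * a
  Σ≤-*ʳ n a f = trans (Σ≤-cong n (λ k → *-comm (f k) a)) (trans (Σ≤-*ˡ n a f) (*-comm a _))

  Σ≤-neg : ∀ n (f : ℕ → Carrier) → Σ≤ n (λ k → - f k) ≈ - Σ≤ n f
  Σ≤-neg zero    f = refl
  Σ≤-neg (suc n) f = trans (+-congʳ (Σ≤-neg n f)) (-‿+-comm _ _)

  Σ≤-zero : ∀ n {f : ℕ → Carrier} → (∀ k → k ≤ n → f k ≈ 0#) → Σ≤ n f ≈ 0#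
  Σ≤-zero zero    f≈0 = f≈0 0 z≤n
  Σ≤-zero (suc n) f≈0 = trans (+-cong (Σ≤-zero n (λ k k≤n → f≈0 k (ℕ.m≤n⇒m≤1+n k≤n))) (f≈0 (suc n) ℕ.≤-refl))
                              (+-identityˡ 0#)

  Σ≤-last : ∀ n {f : ℕ → Carrier} → (∀ k → k < n → f k ≈ 0#) → Σ≤ n f ≈ f n
  Σ≤-last zero    f≈0 = refl
  Σ≤-last (suc n) f≈0 = trans (+-congʳ (Σ≤-zero n (λ k k≤n → f≈0 k (s≤s k≤n)))) (+-identityˡ _)

  Σ≤-suc : ∀ n (f : ℕ → Carrier) → Σ≤ (suc n) f ≈ f 0 + Σ≤ n (λ k → f (suc k))
  Σ≤-suc zero    f = refl
  Σ≤-suc (suc n) f = trans (+-congʳ (Σ≤-suc n f)) (+-assoc _ _ _)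

  Σ≤-reverse : ∀ n (f : ℕ → Carrier) → Σ≤ n f ≈ Σ≤ n (λ k → f (n ∸ k))
  Σ≤-reverse zero    f = refl
  Σ≤-reverse (suc n) f = begin
    Σ≤ n f + f (suc n)                  ≈⟨ +-congʳ (Σ≤-reverse n f) ⟩
    Σ≤ n (λ k → f (n ∸ k)) + f (suc n)  ≈⟨ +-comm _ _ ⟩
    f (suc n) + Σ≤ n (λ k → f (n ∸ k))  ≈⟨ Σ≤-suc n (λ k → f (suc n ∸ k)) ⟨
    Σ≤ (suc n) (λ k → f (suc n ∸ k))    ∎
    where open R-Reasoning

  ι-+ : ∀ m n → ι (m ℕ.+ n) ≈ ι m + ι n
  ι-+ zero    n = sym (+-identityˡ _)
  ι-+ (suc m) n = trans (+-congˡ (ι-+ m n)) (sym (+-assoc _ _ _))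

  ι-1 : ι 1 ≈ 1#
  ι-1 = +-identityʳ 1#

  ι-suc-∸1 : ∀ j → ι (suc j) + - 1# ≈ ι j
  ι-suc-∸1 j = begin
    (1# + ι j) + - 1#  ≈⟨ +-congʳ (+-comm _ _) ⟩
    (ι j + 1#) + - 1#  ≈⟨ +-assoc _ _ _ ⟩
    ι j + (1# + - 1#)  ≈⟨ +-congˡ (-‿inverseʳ _) ⟩
    ι j + 0#           ≈⟨ +-identityʳ _ ⟩
    ι j                ∎
    where open R-Reasoning

  x-y≈-[y-x] : ∀ x y → x + - y ≈ - (y + - x)
  x-y≈-[y-x] x y = begin
    x + - y        ≈⟨ +-comm _ _ ⟩
    - y + x        ≈⟨ +-congˡ (-‿involutive x) ⟨
    - y + - - x    ≈⟨ -‿+-comm _ _ ⟩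
    - (y + - x)    ∎
    where open R-Reasoning

  Σ≤-binomial-suc : ∀ n (Q : ℕ → Carrier) →
    Σ≤ (suc n) (λ k → ι (suc n C k) * Q k) ≈
    Σ≤ n (λ k → ι (n C k) * Q (suc k)) + Σ≤ n (λ k → ι (n C k) * Q k)
  Σ≤-binomial-suc n Q = begin
    Σ≤ (suc n) (λ k → ι (suc n C k) * Q k)     ≈⟨ Σ≤-suc n _ ⟩
    q₀ + Σ≤ n (λ k → ι (suc n C suc k) * Q (suc k))
      ≈⟨ +-congˡ (trans (Σ≤-cong n pascal) (Σ≤-distrib-+ n _ _)) ⟩
    q₀ + (shifted + unshifted₊)                ≈⟨ solve 3 (λ q a b → q :+ (a :+ b) := a :+ (q :+ b)) refl q₀ shifted unshifted₊ ⟩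
    shifted + (q₀ + unshifted₊)                ≈⟨ +-congˡ unshifted-split ⟨
    shifted + Σ≤ n (λ k → ι (n C k) * Q k)     ∎
    where
    open R-Reasoning
    q₀ = ι 1 * Q 0
    shifted = Σ≤ n (λ k → ι (n C k) * Q (suc k))
    unshifted₊ = Σ≤ n (λ k → ι (n C suc k) * Q (suc k))
    pascal : ∀ k → ι (suc n C suc k) * Q (suc k) ≈ ι (n C k) * Q (suc k) + ι (n C suc k) * Q (suc k)
    pascal k = trans (*-congʳ (trans (reflexive (P.cong ι (P.sym (nCk+nC[k+1]≡[n+1]C[k+1] n k))))
                                     (ι-+ (n C k) (n C suc k))))
                     (distribʳ _ _ _)
    unshifted-split : Σ≤ n (λ k → ι (n C k) * Q k) ≈ q₀ + unshifted₊
    unshifted-split = begin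
      Σ≤ n (λ k → ι (n C k) * Q k)            ≈⟨ +-identityʳ _ ⟨
      Σ≤ n (λ k → ι (n C k) * Q k) + 0#       ≈⟨ +-congˡ (trans (*-congʳ (reflexive (P.cong ι (k>n⇒nCk≡0 (ℕ.n<1+n n))))) (zeroˡ _)) ⟨
      Σ≤ (suc n) (λ k → ι (n C k) * Q k)      ≈⟨ Σ≤-suc n _ ⟩
      q₀ + unshifted₊                         ∎

  ff-cong : ∀ {y y′} μ n → y ≈ y′ → ff y μ n ≈ ff y′ μ n
  ff-cong μ zero    y≈y′ = refl
  ff-cong μ (suc n) y≈y′ = *-cong (ff-cong μ n y≈y′) (+-congʳ y≈y′)

  ff-0#-suc : ∀ μ n → ff 0# μ (suc n) ≈ 0#
  ff-0#-suc μ zero    = trans (*-identityˡ _) (trans (+-identityˡ _) (trans (-‿cong (zeroˡ μ)) -0#≈0#))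
  ff-0#-suc μ (suc n) = trans (*-congʳ (ff-0#-suc μ n)) (zeroˡ _)

  -- The factor (a + b) - nμ of (a + b)_{n+1,μ} is shared out between the two
  -- factors produced by the Pascal recurrence.
  +-∸-ι*-split : ∀ a b μ n k → k ≤ n →
    (a + b) + - (ι n * μ) ≈ (a + - (ι k * μ)) + (b + - (ι (n ∸ k) * μ))
  +-∸-ι*-split a b μ n k k≤n = begin
    (a + b) + - (ι n * μ)                          ≈⟨ +-congˡ (-‿cong (*-congʳ n≈k+[n-k])) ⟩
    (a + b) + - ((ι k + ι (n ∸ k)) * μ)            ≈⟨ +-congˡ (-‿cong (distribʳ _ _ _)) ⟩
    (a + b) + - (ι k * μ + ι (n ∸ k) * μ)          ≈⟨ +-congˡ (-‿+-comm _ _) ⟨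
    (a + b) + (- (ι k * μ) + - (ι (n ∸ k) * μ))    ≈⟨ solve 4 (λ a b p q → (a :+ b) :+ (p :+ q) := (a :+ p) :+ (b :+ q)) refl a b _ _ ⟩
    (a + - (ι k * μ)) + (b + - (ι (n ∸ k) * μ))    ∎
    where
    open R-Reasoning
    n≈k+[n-k] : ι n ≈ ι k + ι (n ∸ k)
    n≈k+[n-k] = trans (reflexive (P.cong ι (P.sym (ℕ.m+[n∸m]≡n k≤n)))) (ι-+ k (n ∸ k))

  ff-vandermonde : ∀ a b μ n → Σ≤ n (λ k → ι (n C k) * (ff a μ k * ff b μ (n ∸ k))) ≈ ff (a + b) μ n
  ff-vandermonde a b μ zero    = trans (*-congʳ ι-1) (trans (*-identityˡ _) (*-identityˡ _))
  ff-vandermonde a b μ (suc n) = begin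
    Σ≤ (suc n) (λ k → ι (suc n C k) * Q k)                              ≈⟨ Σ≤-binomial-suc n Q ⟩
    Σ≤ n (λ k → ι (n C k) * Q (suc k)) + Σ≤ n (λ k → ι (n C k) * Q k)  ≈⟨ Σ≤-distrib-+ n _ _ ⟨
    Σ≤ n (λ k → ι (n C k) * Q (suc k) + ι (n C k) * Q k)                ≈⟨ Σ≤-cong≤ n pascal-step ⟩
    Σ≤ n (λ k → term k * z)                                             ≈⟨ Σ≤-*ʳ n z term ⟩
    Σ≤ n term * z                                                       ≈⟨ *-congʳ (ff-vandermonde a b μ n) ⟩
    ff (a + b) μ (suc n)                                                ∎
    where
    open R-Reasoning
    Q : ℕ → Carrier
    Q k = ff a μ k * ff b μ (suc n ∸ k)
    term : ℕ → Carrier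
    term k = ι (n C k) * (ff a μ k * ff b μ (n ∸ k))
    z = (a + b) + - (ι n * μ)
    pascal-step : ∀ k → k ≤ n → ι (n C k) * Q (suc k) + ι (n C k) * Q k ≈ term k * z
    pascal-step k k≤n rewrite ℕ.+-∸-assoc 1 k≤n = sym (begin
      term k * z
        ≈⟨ *-congˡ (+-∸-ι*-split a b μ n k k≤n) ⟩
      term k * ((a + - (ι k * μ)) + (b + - (ι (n ∸ k) * μ)))
        ≈⟨ solve 5 (λ c F G u v → c :* (F :* G) :* (u :+ v) := c :* (F :* u :* G) :+ c :* (F :* (G :* v)))
                   refl (ι (n C k)) (ff a μ k) (ff b μ (n ∸ k)) _ _ ⟩
      ι (n C k) * (ff a μ (suc k) * ff b μ (n ∸ k)) + ι (n C k) * (ff a μ k * ff b μ (suc (n ∸ k))) ∎)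

  PS-setoid : Setoid c ℓ
  PS-setoid = record
    { Carrier = PS
    ; _≈_ = _≈PS_
    ; isEquivalence = record
      { refl = λ _ → refl ; sym = λ f≈g j → sym (f≈g j) ; trans = λ f≈g g≈h j → trans (f≈g j) (g≈h j) }
    }
  module PS = Setoid PS-setoid
  module PS-Reasoning = SetoidReasoning PS-setoid

  shift : PS → PS
  shift f j = f (suc j)

  ΣPS : ℕ → (ℕ → PS) → PS
  ΣPS n F j = Σ≤ n (λ k → F k j)

  ΣPS-cong≤ : ∀ n {F G : ℕ → PS} → (∀ k → k ≤ n → F k ≈PS G k) → ΣPS n F ≈PS ΣPS n G
  ΣPS-cong≤ n F≈G j = Σ≤-cong≤ n (λ k k≤n → F≈G k k≤n j)

  ⊕-cong : ∀ {f f′ g g′} → f ≈PS f′ → g ≈PS g′ → (f ⊕ g) ≈PS (f′ ⊕ g′)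
  ⊕-cong f≈f′ g≈g′ j = +-cong (f≈f′ j) (g≈g′ j)

  ⊖-cong : ∀ {f f′} → f ≈PS f′ → (⊖ f) ≈PS (⊖ f′)
  ⊖-cong f≈f′ j = -‿cong (f≈f′ j)

  ·PS-congˡ : ∀ a {f g} → f ≈PS g → (a ·PS f) ≈PS (a ·PS g)
  ·PS-congˡ a f≈g j = *-congˡ (f≈g j)

  ·PS-assoc : ∀ a b f → (a ·PS (b ·PS f)) ≈PS ((a * b) ·PS f)
  ·PS-assoc a b f j = sym (*-assoc _ _ _)

  ⊛-congˡ : ∀ {f f′} g → f ≈PS f′ → (f ⊛ g) ≈PS (f′ ⊛ g)
  ⊛-congˡ g f≈f′ j = Σ≤-cong j (λ k → *-congʳ (f≈f′ k))

  ⊛-congʳ : ∀ f {g g′} → g ≈PS g′ → (f ⊛ g) ≈PS (f ⊛ g′)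
  ⊛-congʳ f g≈g′ j = Σ≤-cong j (λ k → *-congˡ (g≈g′ (j ∸ k)))

  ⊛-comm : ∀ f g → (f ⊛ g) ≈PS (g ⊛ f)
  ⊛-comm f g j = trans (Σ≤-reverse j _)
    (Σ≤-cong≤ j (λ k k≤j → trans (*-comm _ _) (*-congʳ (reflexive (P.cong g (ℕ.m∸[m∸n]≡n k≤j))))))

  ⊛-distribˡ-⊕ : ∀ h f g → (h ⊛ (f ⊕ g)) ≈PS ((h ⊛ f) ⊕ (h ⊛ g))
  ⊛-distribˡ-⊕ h f g j = trans (Σ≤-cong j (λ k → distribˡ _ _ _)) (Σ≤-distrib-+ j _ _)

  ⊛-distribʳ-⊕ : ∀ h f g → ((f ⊕ g) ⊛ h) ≈PS ((f ⊛ h) ⊕ (g ⊛ h))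
  ⊛-distribʳ-⊕ h f g j = trans (Σ≤-cong j (λ k → distribʳ _ _ _)) (Σ≤-distrib-+ j _ _)

  ⊛-negʳ : ∀ f g → (f ⊛ (⊖ g)) ≈PS (⊖ (f ⊛ g))
  ⊛-negʳ f g j = trans (Σ≤-cong j (λ k → sym (-‿distribʳ-* _ _))) (Σ≤-neg j _)

  ⊛-distribˡ-⊖ : ∀ h f g → (h ⊛ (f ⊕ (⊖ g))) ≈PS ((h ⊛ f) ⊕ (⊖ (h ⊛ g)))
  ⊛-distribˡ-⊖ h f g = PS.trans (⊛-distribˡ-⊕ h f (⊖ g)) (⊕-cong PS.refl (⊛-negʳ h g))

  ⊛-·PSˡ : ∀ a f g → ((a ·PS f) ⊛ g) ≈PS (a ·PS (f ⊛ g))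
  ⊛-·PSˡ a f g j = trans (Σ≤-cong j (λ k → *-assoc _ _ _)) (Σ≤-*ˡ j a _)

  ⊛-·PSʳ : ∀ a f g → (f ⊛ (a ·PS g)) ≈PS (a ·PS (f ⊛ g))
  ⊛-·PSʳ a f g j =
    trans (Σ≤-cong j (λ k → solve 3 (λ x a y → x :* (a :* y) := a :* (x :* y)) refl _ a _)) (Σ≤-*ˡ j a _)

  ⊛-zeroʳ : ∀ f → (f ⊛ 0PS) ≈PS 0PS
  ⊛-zeroʳ f j = Σ≤-zero j (λ k _ → zeroʳ _)

  constPS-⊛ : ∀ a f → (constPS a ⊛ f) ≈PS (a ·PS f)
  constPS-⊛ a f zero    = refl
  constPS-⊛ a f (suc j) = trans (Σ≤-suc j _) (trans (+-congˡ (Σ≤-zero j (λ k _ → zeroˡ _))) (+-identityʳ _))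

  ⊛-constPS : ∀ a f → (f ⊛ constPS a) ≈PS (a ·PS f)
  ⊛-constPS a f = PS.trans (⊛-comm f (constPS a)) (constPS-⊛ a f)

  ⊛-identityʳ : ∀ f → (f ⊛ 1PS) ≈PS f
  ⊛-identityʳ f j = trans (⊛-constPS 1# f j) (*-identityˡ _)

  tPS-⊛-suc : ∀ f j → (tPS ⊛ f) (suc j) ≈ f j
  tPS-⊛-suc f j = trans (Σ≤-suc j _) (trans (+-cong (zeroˡ _) (⊛-congˡ f shift-tPS j))
                                            (trans (+-identityˡ _) (trans (constPS-⊛ 1# f j) (*-identityˡ _))))
    where
    shift-tPS : shift tPS ≈PS 1PS
    shift-tPS zero    = refl
    shift-tPS (suc j) = refl

  tPS-⊛-shift : ∀ f → ((tPS ⊛ shift f) ⊕ (⊖ f)) ≈PS constPS (- f 0)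
  tPS-⊛-shift f zero    = trans (+-congʳ (zeroˡ _)) (+-identityˡ _)
  tPS-⊛-shift f (suc j) = trans (+-congʳ (tPS-⊛-suc (shift f) j)) (-‿inverseʳ _)

  shift-⊛ : ∀ f g → shift (f ⊛ g) ≈PS ((f 0 ·PS shift g) ⊕ (shift f ⊛ g))
  shift-⊛ f g j = Σ≤-suc j _

  ⊛-assoc : ∀ f g h → ((f ⊛ g) ⊛ h) ≈PS (f ⊛ (g ⊛ h))
  ⊛-assoc f g h zero    = *-assoc _ _ _
  ⊛-assoc f g h (suc n) = begin
    ((f ⊛ g) ⊛ h) (suc n)
      ≈⟨ Σ≤-suc n _ ⟩
    f₀ * g 0 * h (suc n) + (shift (f ⊛ g) ⊛ h) n
      ≈⟨ +-congˡ (⊛-congˡ h (shift-⊛ f g) n) ⟩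
    f₀ * g 0 * h (suc n) + (((f₀ ·PS shift g) ⊕ (shift f ⊛ g)) ⊛ h) n
      ≈⟨ +-congˡ (⊛-distribʳ-⊕ h _ _ n) ⟩
    f₀ * g 0 * h (suc n) + (((f₀ ·PS shift g) ⊛ h) n + ((shift f ⊛ g) ⊛ h) n)
      ≈⟨ +-congˡ (+-cong (⊛-·PSˡ f₀ (shift g) h n) (⊛-assoc (shift f) g h n)) ⟩
    f₀ * g 0 * h (suc n) + (f₀ * (shift g ⊛ h) n + (shift f ⊛ (g ⊛ h)) n)
      ≈⟨ solve 5 (λ x y z w v → x :* y :* z :+ (x :* w :+ v) := x :* (y :* z :+ w) :+ v) refl f₀ (g 0) (h (suc n)) _ _ ⟩
    f₀ * (g 0 * h (suc n) + (shift g ⊛ h) n) + (shift f ⊛ (g ⊛ h)) n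
      ≈⟨ +-congʳ (*-congˡ (Σ≤-suc n _)) ⟨
    f₀ * (g ⊛ h) (suc n) + (shift f ⊛ (g ⊛ h)) n
      ≈⟨ Σ≤-suc n _ ⟨
    (f ⊛ (g ⊛ h)) (suc n) ∎
    where
    open R-Reasoning
    f₀ = f 0

  ^PS-+ : ∀ f a b → ((f ^PS a) ⊛ (f ^PS b)) ≈PS (f ^PS (a ℕ.+ b))
  ^PS-+ f a zero    = PS.trans (⊛-identityʳ _) (PS.reflexive (P.cong (f ^PS_) (P.sym (ℕ.+-identityʳ a))))
  ^PS-+ f a (suc b) = begin
    (f ^PS a) ⊛ ((f ^PS b) ⊛ f)   ≈⟨ ⊛-assoc (f ^PS a) (f ^PS b) f ⟨
    ((f ^PS a) ⊛ (f ^PS b)) ⊛ f   ≈⟨ ⊛-congˡ f (^PS-+ f a b) ⟩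
    (f ^PS (a ℕ.+ b)) ⊛ f         ≡⟨ P.cong (f ^PS_) (P.sym (ℕ.+-suc a b)) ⟩
    f ^PS (a ℕ.+ suc b)           ∎
    where open PS-Reasoning

  ⊛-ΣPS : ∀ w n F → (w ⊛ ΣPS n F) ≈PS ΣPS n (λ k → w ⊛ F k)
  ⊛-ΣPS w zero    F j = refl
  ⊛-ΣPS w (suc n) F j = trans (⊛-distribˡ-⊕ w (ΣPS n F) (F (suc n)) j) (+-congʳ (⊛-ΣPS w n F j))

  tMinusOne≈⊖oneMinusT : tMinusOne ≈PS (⊖ oneMinusT)
  tMinusOne≈⊖oneMinusT j = x-y≈-[y-x] _ _

  ⋆-distribˡ-⊞ : ∀ F G H → (F ⋆ (G ⊞ H)) ≈EPS ((F ⋆ G) ⊞ (F ⋆ H))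
  ⋆-distribˡ-⊞ F G H n j = trans
    (Σ≤-cong n (λ k → trans (*-congˡ (⊛-distribˡ-⊕ (F k) (G (n ∸ k)) (H (n ∸ k)) j)) (distribˡ _ _ _)))
    (Σ≤-distrib-+ n _ _)

  ⋆-negʳ : ∀ F G → (F ⋆ (⊟ G)) ≈EPS (⊟ (F ⋆ G))
  ⋆-negʳ F G n j = trans
    (Σ≤-cong n (λ k → trans (*-congˡ (⊛-negʳ (F k) (G (n ∸ k)) j)) (sym (-‿distribʳ-* _ _))))
    (Σ≤-neg n _)

  ⋆-constE : ∀ F p n → (F ⋆ constE p) n ≈PS (F n ⊛ p)
  ⋆-constE F p n j = trans (Σ≤-last n lower-terms) top-term
    where
    lower-terms : ∀ k → k < n → ι (n C k) * (F k ⊛ constE p (n ∸ k)) j ≈ 0#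
    lower-terms k k<n rewrite ℕ.+-∸-assoc 1 k<n = trans (*-congˡ (⊛-zeroʳ (F k) j)) (zeroʳ _)
    top-term : ι (n C n) * (F n ⊛ constE p (n ∸ n)) j ≈ (F n ⊛ p) j
    top-term rewrite nCn≡1 n | ℕ.n∸n≡0 n = trans (*-congʳ ι-1) (*-identityˡ _)

  module _ (lam : Carrier) where

    -- Σⱼ (j)_{n,λ} tʲ; the paper's series Σⱼ (j+1)_{n,λ} tʲ is its shift.
    ffSeries : ℕ → PS
    ffSeries n j = ff (ι j) lam n

    -- The inductive step of eDegAt-neg: the new factors (1 - m(-λ))(t - 1) and (-1 - mλ)(1 - t) agree.
    eDeg-step : ∀ m v → (1# + - (ι m * - lam)) * - (ff (- 1#) lam m * v) ≈ ff (- 1#) lam (suc m) * v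
    eDeg-step m v = begin
      x * - (d * v)    ≈⟨ -‿distribʳ-* _ _ ⟨
      - (x * (d * v))  ≈⟨ -‿distribˡ-* _ _ ⟩
      - x * (d * v)    ≈⟨ solve 3 (λ y a b → y :* (a :* b) := a :* y :* b) refl (- x) d v ⟩
      d * - x * v      ≈⟨ *-congʳ (*-congˡ -x≈-1-mλ) ⟩
      ff (- 1#) lam (suc m) * v ∎
      where
      open R-Reasoning
      x = 1# + - (ι m * - lam)
      d = ff (- 1#) lam m
      -x≈-1-mλ : - x ≈ - 1# + - (ι m * lam)
      -x≈-1-mλ = begin
        - (1# + - (ι m * - lam))   ≈⟨ -‿+-comm _ _ ⟨
        - 1# + - - (ι m * - lam)   ≈⟨ +-congˡ (-‿involutive _) ⟩
        - 1# + ι m * - lam         ≈⟨ +-congˡ (-‿distribʳ-* _ _) ⟨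
        - 1# + - (ι m * lam)       ∎

    eDegAt-neg : ∀ m → eDegAt (- lam) m ≈PS (ff (- 1#) lam m ·PS (oneMinusT ^PS m))
    eDegAt-neg zero    j = refl
    eDegAt-neg (suc m) = begin
      (ff 1# (- lam) m * x) ·PS ((T ^PS m) ⊛ T)           ≈⟨ (λ j → trans (*-congʳ (*-comm _ _)) (*-assoc _ _ _)) ⟩
      x ·PS (ff 1# (- lam) m ·PS ((T ^PS m) ⊛ T))         ≈⟨ ·PS-congˡ x (⊛-·PSˡ _ (T ^PS m) T) ⟨
      x ·PS (eDegAt (- lam) m ⊛ T)                        ≈⟨ ·PS-congˡ x (PS.trans (⊛-congˡ T (eDegAt-neg m)) (⊛-congʳ _ tMinusOne≈⊖oneMinusT)) ⟩
      x ·PS ((d ·PS (U ^PS m)) ⊛ (⊖ U))                   ≈⟨ ·PS-congˡ x (PS.trans (⊛-negʳ _ U) (⊖-cong (⊛-·PSˡ _ (U ^PS m) U))) ⟩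
      x ·PS (⊖ (d ·PS (U ^PS suc m)))                     ≈⟨ (λ j → eDeg-step m ((U ^PS suc m) j)) ⟩
      ff (- 1#) lam (suc m) ·PS (U ^PS suc m)             ∎
      where
      open PS-Reasoning
      x = 1# + - (ι m * - lam)
      d = ff (- 1#) lam m
      T = tMinusOne
      U = oneMinusT

    A-⊛-eDegAt-neg : ∀ n k → k ≤ n →
      (A lam k ⊛ eDegAt (- lam) (n ∸ k)) ≈PS
      (ff (- 1#) lam (n ∸ k) ·PS ((oneMinusT ^PS suc n) ⊛ shift (ffSeries k)))
    A-⊛-eDegAt-neg n k k≤n = begin
      A lam k ⊛ eDegAt (- lam) m                    ≈⟨ ⊛-congʳ (A lam k) (eDegAt-neg m) ⟩
      A lam k ⊛ (d ·PS (U ^PS m))                   ≈⟨ ⊛-·PSʳ d (A lam k) (U ^PS m) ⟩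
      d ·PS (A lam k ⊛ (U ^PS m))                   ≈⟨ ·PS-congˡ d (⊛-comm (A lam k) (U ^PS m)) ⟩
      d ·PS ((U ^PS m) ⊛ ((U ^PS suc k) ⊛ g))       ≈⟨ ·PS-congˡ d (⊛-assoc (U ^PS m) (U ^PS suc k) g) ⟨
      d ·PS (((U ^PS m) ⊛ (U ^PS suc k)) ⊛ g)       ≈⟨ ·PS-congˡ d (⊛-congˡ g (^PS-+ U m (suc k))) ⟩
      d ·PS ((U ^PS (m ℕ.+ suc k)) ⊛ g)             ≡⟨ P.cong (λ e → d ·PS ((U ^PS e) ⊛ g)) m+[k+1]≡n+1 ⟩
      d ·PS ((U ^PS suc n) ⊛ g)                     ∎
      where
      open PS-Reasoning
      m = n ∸ k
      d = ff (- 1#) lam m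
      U = oneMinusT
      g = shift (ffSeries k)
      m+[k+1]≡n+1 : m ℕ.+ suc k ≡ suc n
      m+[k+1]≡n+1 = P.trans (ℕ.+-suc m k) (P.cong suc (ℕ.m∸n+n≡m k≤n))

    Agen-⋆-eDegAt-neg : ∀ n → (Agen lam ⋆ eDegAt (- lam)) n ≈PS ((oneMinusT ^PS suc n) ⊛ ffSeries n)
    Agen-⋆-eDegAt-neg n = begin
      ΣPS n (λ k → ι (n C k) ·PS (A lam k ⊛ eDegAt (- lam) (n ∸ k)))
        ≈⟨ ΣPS-cong≤ n (λ k k≤n → PS.trans (·PS-congˡ _ (A-⊛-eDegAt-neg n k k≤n)) (·PS-assoc _ _ _)) ⟩
      ΣPS n (λ k → coeff k ·PS (Uⁿ⁺¹ ⊛ shift (ffSeries k)))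
        ≈⟨ ΣPS-cong≤ n (λ k _ → ⊛-·PSʳ (coeff k) Uⁿ⁺¹ (shift (ffSeries k))) ⟨
      ΣPS n (λ k → Uⁿ⁺¹ ⊛ (coeff k ·PS shift (ffSeries k)))
        ≈⟨ ⊛-ΣPS Uⁿ⁺¹ n (λ k → coeff k ·PS shift (ffSeries k)) ⟨
      Uⁿ⁺¹ ⊛ ΣPS n (λ k → coeff k ·PS shift (ffSeries k))
        ≈⟨ ⊛-congʳ Uⁿ⁺¹ vandermonde ⟩
      Uⁿ⁺¹ ⊛ ffSeries n ∎
      where
      open PS-Reasoning
      Uⁿ⁺¹ = oneMinusT ^PS suc n
      coeff : ℕ → Carrier
      coeff k = ι (n C k) * ff (- 1#) lam (n ∸ k)
      vandermonde : ΣPS n (λ k → coeff k ·PS shift (ffSeries k)) ≈PS ffSeries n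
      vandermonde j = trans
        (Σ≤-cong n (λ k → solve 3 (λ c d g → c :* d :* g := c :* (g :* d)) refl _ _ _))
        (trans (ff-vandermonde (ι (suc j)) (- 1#) lam n) (ff-cong lam n (ι-suc-∸1 j)))

    oneMinusT^-·-ff0 : ∀ n → ((- ff 0# lam n) ·PS (oneMinusT ^PS suc n)) ≈PS constE tMinusOne n
    oneMinusT^-·-ff0 zero    j = trans (*-congˡ (trans (constPS-⊛ 1# oneMinusT j) (*-identityˡ _)))
                                      (trans (-1*x≈-x _) (sym (tMinusOne≈⊖oneMinusT j)))
    oneMinusT^-·-ff0 (suc n) j = trans (*-congʳ (trans (-‿cong (ff-0#-suc lam n)) -0#≈0#)) (zeroˡ _)

theorem9 : {c ℓ : Level} (R : CommutativeRing c ℓ) (lam : CommutativeRing.Carrier R) →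
    let open Series R in
    (Agen lam ⋆ denom lam) ≈EPS constE tMinusOne
theorem9 R lam n = begin
  (Agen lam ⋆ denom lam) n
    ≈⟨ ⋆-distribˡ-⊞ (Agen lam) (constE tPS) (⊟ eDegAt (- lam)) n ⟩
  (Agen lam ⋆ constE tPS) n ⊕ (Agen lam ⋆ (⊟ eDegAt (- lam))) n
    ≈⟨ ⊕-cong (⋆-constE (Agen lam) tPS n) (PS.trans (⋆-negʳ (Agen lam) (eDegAt (- lam)) n) (⊖-cong (Agen-⋆-eDegAt-neg lam n))) ⟩
  (A lam n ⊛ tPS) ⊕ (⊖ (Uⁿ⁺¹ ⊛ ffSeries lam n))
    ≈⟨ ⊕-cong (PS.trans (⊛-assoc Uⁿ⁺¹ gₙ tPS) (⊛-congʳ Uⁿ⁺¹ (⊛-comm gₙ tPS))) PS.refl ⟩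
  (Uⁿ⁺¹ ⊛ (tPS ⊛ shift (ffSeries lam n))) ⊕ (⊖ (Uⁿ⁺¹ ⊛ ffSeries lam n))
    ≈⟨ ⊛-distribˡ-⊖ Uⁿ⁺¹ (tPS ⊛ gₙ) (ffSeries lam n) ⟨
  Uⁿ⁺¹ ⊛ ((tPS ⊛ shift (ffSeries lam n)) ⊕ (⊖ ffSeries lam n))
    ≈⟨ ⊛-congʳ Uⁿ⁺¹ (tPS-⊛-shift (ffSeries lam n)) ⟩
  Uⁿ⁺¹ ⊛ constPS (- ff (ι 0) lam n)
    ≈⟨ ⊛-constPS (- ff 0# lam n) Uⁿ⁺¹ ⟩
  (- ff 0# lam n) ·PS Uⁿ⁺¹
    ≈⟨ oneMinusT^-·-ff0 lam n ⟩
  constE tMinusOne n ∎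
  where
  open CommutativeRing R using (-_; 0#)
  open Series R
  open SeriesLemmas R
  open PS-Reasoning
  Uⁿ⁺¹ = oneMinusT ^PS suc n
  gₙ = shift (ffSeries lam n)
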